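{- Let $p = 1^i 0^j 1^k$ for integers $i,k \ge 0$ and $j \ge 1$. For every $n \ge i+j+k$, $$M_{n,p} = \max\left\{ \binom{a}{i}\binom{b}{j}\binom{c}{k} \;\middle|\; a,b,c \ge 0,\ a+b+c = n\right\}.$$
   Context: A binary word is a finite sequence over $\{0,1\}$; $x^m$ denotes $m$ consecutive copies of the letter $x$. An occurrence of $p = p_1\cdots p_l$ in $w = w_1\cdots w_n$ is a choice of indices $1 \le i_1 < \cdots < i_l \le n$ with $w_{i_1}\cdots w_{i_l} = p$; $c_p(w)$ is the number of occurrences. $M_{n,p} = \max\{c_p(w) : w \in \{0,1\}^n\}$. -}

module Defs where

open import Data.Bool using (Bool; true; false; if_then_else_)
open import Data.Bool.Properties using () renaming (_≟_ to _≟ᵇ_)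
open import Data.Nat using (ℕ; zero; suc; _+_; _*_; _∸_; _⊔_)
open import Data.Nat.Combinatorics using (_C_)
open import Data.List using (List; []; _∷_; map; concatMap; foldr; replicate; _++_; upTo)
open import Relation.Nullary.Decidable using (⌊_⌋)

-- Binary letters: false = 0, true = 1.
Word : Set
Word = List Bool

-- c p w : number of occurrences of p in w as a (scattered) subsequence,
-- i.e. number of index choices i₁ < … < i_l with w_{i₁}…w_{i_l} = p.
-- Recursion: an occurrence either does not use the first letter of w,
-- or uses it to match the first letter of p.
c : Word → Word → ℕ
c []      w       = 1
c (x ∷ p) []      = 0
c (x ∷ p) (y ∷ w) = c (x ∷ p) w + (if ⌊ x ≟ᵇ y ⌋ then c p w else 0)

words : ℕ → List Word
words zero    = [] ∷ []
words (suc n) = concatMap (λ w → (false ∷ w) ∷ (true ∷ w) ∷ []) (words n)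

maximum : List ℕ → ℕ
maximum = foldr _⊔_ 0

M : ℕ → Word → ℕ
M n p = maximum (map (c p) (words n))

tripleMax : ℕ → ℕ → ℕ → ℕ → ℕ
tripleMax n i j k =
  maximum (concatMap (λ a → map (λ b → (a C i) * (b C j) * ((n ∸ a ∸ b) C k))
                                (upTo (suc (n ∸ a))))
                     (upTo (suc n)))

pat : ℕ → ℕ → ℕ → Word
pat i j k = replicate i true ++ replicate j false ++ replicate k true

-- Let w have z zeros and m ones, and let B bound C(a,i)·C(m−a,k) for all a ≤ m.
-- Classify the occurrences of 1^i 0^j 1^k in w by the zero of w playing the first
-- 0 of the pattern: if s ones precede it and z′ zeros follow it, there are at most
-- C(s,i)·C(z′,j−1)·C(m−s,k) ≤ C(z′,j−1)·B of them, and summing over the zeros gives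
-- at most C(z,j)·B by the hockey-stick identity.  Choosing B attained at some a, this is the
-- term (a, z, m−a) of the triple maximum.  Conversely 1^a 0^b 1^c contains exactly
-- C(a,i)·C(b,j)·C(c,k) occurrences, the three blocks of the pattern being forced
-- into the three blocks of the word.

module Submission where

open import Defs
open import Data.Nat using (ℕ; zero; suc; _+_; _*_; _∸_; _≤_; z≤n; s≤s)
open import Data.Nat.Properties
open import Data.Nat.Combinatorics using (_C_; nCk+nC[k+1]≡[n+1]C[k+1])
open import Data.Bool using (Bool; true; false; not; if_then_else_)
open import Data.Bool.Properties using () renaming (_≟_ to _≟ᵇ_)
open import Data.List using (List; []; _∷_; map; replicate; _++_; length; upTo)
open import Data.List.Properties using (++-identityʳ; length-++; length-replicate)
open import Data.List.Membership.Propositional using (_∈_; find; lose)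
open import Data.List.Membership.Propositional.Properties
  using (∈-++⁺ʳ; ∈-map⁺; ∈-concatMap⁺; ∈-concatMap⁻; ∈-upTo⁺; ∈-upTo⁻)
open import Data.List.Relation.Unary.Any using (here; there)
open import Data.List.Relation.Unary.All as All using (All; []; _∷_)
open import Data.List.Relation.Unary.All.Properties using (map⁺; concat⁺)
open import Data.List.Extrema.Nat using (argmax; argmax-all; f[xs]≤f[argmax])
open import Data.Product using (∃-syntax; _×_; _,_)
open import Algebra.Properties.CommutativeSemigroup +-commutativeSemigroup using (interchange)
open import Algebra.Properties.CommutativeSemigroup *-commutativeSemigroup using (x∙yz≈y∙xz)
open import Relation.Nullary using (yes; no)
open import Relation.Nullary.Decidable using (⌊_⌋)
open import Relation.Binary.PropositionalEquality using (_≡_; refl; sym; trans; cong; cong₂; subst; module ≡-Reasoning)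

ones zeros : ℕ → Word
ones n  = replicate n true
zeros n = replicate n false

count : Bool → Word → ℕ
count x []      = 0
count x (y ∷ w) = if ⌊ x ≟ᵇ y ⌋ then suc (count x w) else count x w

count-false+count-true : ∀ w → count false w + count true w ≡ length w
count-false+count-true []          = refl
count-false+count-true (false ∷ w) = cong suc (count-false+count-true w)
count-false+count-true (true ∷ w)  =
  trans (+-suc (count false w) (count true w)) (cong suc (count-false+count-true w))

nC[k+1]*x+nCk*x≡[n+1]C[k+1]*x : ∀ n k x → (n C suc k) * x + (n C k) * x ≡ (suc n C suc k) * x
nC[k+1]*x+nCk*x≡[n+1]C[k+1]*x n k x = begin
  (n C suc k) * x + (n C k) * x ≡⟨ sym (*-distribʳ-+ x (n C suc k) (n C k)) ⟩
  ((n C suc k) + (n C k)) * x   ≡⟨ cong (_* x) (+-comm (n C suc k) (n C k)) ⟩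
  ((n C k) + (n C suc k)) * x   ≡⟨ cong (_* x) (nCk+nC[k+1]≡[n+1]C[k+1] n k) ⟩
  (suc n C suc k) * x           ∎
  where open ≡-Reasoning

c-∷-≤ : ∀ p y w → c p w ≤ c p (y ∷ w)
c-∷-≤ []      y w = ≤-refl
c-∷-≤ (x ∷ p) y w = m≤m+n (c (x ∷ p) w) _

c-∷-∷ : ∀ x p w → c (x ∷ p) (x ∷ w) ≡ c (x ∷ p) w + c p w
c-∷-∷ false p w = refl
c-∷-∷ true  p w = refl

Ignores : Word → Bool → Set
Ignores p x = ∀ w → c p (x ∷ w) ≡ c p w

∷-ignores-not : ∀ x p → Ignores (x ∷ p) (not x)
∷-ignores-not false p w = +-identityʳ _
∷-ignores-not true  p w = +-identityʳ _

ones-ignores-false : ∀ k → Ignores (ones k) false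
ones-ignores-false zero    = λ _ → refl
ones-ignores-false (suc k) = ∷-ignores-not true (ones k)

ignores-replicate : ∀ p x → Ignores p x → ∀ b w → c p (replicate b x ++ w) ≡ c p w
ignores-replicate p x p-ign zero    w = refl
ignores-replicate p x p-ign (suc b) w = trans (p-ign _) (ignores-replicate p x p-ign b w)

c-ones-≡0 : ∀ {p} → false ∈ p → ∀ n → c p (ones n) ≡ 0
c-ones-≡0 {_ ∷ _}     _            zero    = refl
c-ones-≡0 {false ∷ p} f∈p          (suc n) = trans (+-identityʳ _) (c-ones-≡0 f∈p n)
c-ones-≡0 {true ∷ p}  (there f∈p)  (suc n) =
  cong₂ _+_ (c-ones-≡0 (there f∈p) n) (c-ones-≡0 f∈p n)

c-replicate-++ : ∀ x p u → Ignores p x → (∀ i → c (x ∷ replicate i x ++ p) u ≡ 0) →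
                 ∀ i a → c (replicate i x ++ p) (replicate a x ++ u) ≡ (a C i) * c p u
c-replicate-++ x p u p-ign no-x∷ zero    zero    = sym (*-identityˡ (c p u))
c-replicate-++ x p u p-ign no-x∷ (suc i) zero    = no-x∷ i
c-replicate-++ x p u p-ign no-x∷ zero    (suc a) =
  trans (p-ign (replicate a x ++ u)) (c-replicate-++ x p u p-ign no-x∷ zero a)
c-replicate-++ x p u p-ign no-x∷ (suc i) (suc a) = begin
  c (x ∷ xⁱ ++ p) (x ∷ xᵃ ++ u)                           ≡⟨ c-∷-∷ x (xⁱ ++ p) (xᵃ ++ u) ⟩
  c (x ∷ xⁱ ++ p) (xᵃ ++ u) + c (xⁱ ++ p) (xᵃ ++ u)
    ≡⟨ cong₂ _+_ (c-replicate-++ x p u p-ign no-x∷ (suc i) a) (c-replicate-++ x p u p-ign no-x∷ i a) ⟩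
  (a C suc i) * c p u + (a C i) * c p u                   ≡⟨ nC[k+1]*x+nCk*x≡[n+1]C[k+1]*x a i (c p u) ⟩
  (suc a C suc i) * c p u                                 ∎
  where
  open ≡-Reasoning
  xⁱ = replicate i x
  xᵃ = replicate a x

c-replicate-replicate : ∀ x k n → c (replicate k x) (replicate n x) ≡ n C k
c-replicate-replicate x k n = begin
  c (replicate k x) (replicate n x)
    ≡⟨ sym (cong₂ c (++-identityʳ (replicate k x)) (++-identityʳ (replicate n x))) ⟩
  c (replicate k x ++ []) (replicate n x ++ []) ≡⟨ c-replicate-++ x [] [] (λ _ → refl) (λ _ → refl) k n ⟩
  (n C k) * 1                                   ≡⟨ *-identityʳ (n C k) ⟩
  n C k                                         ∎
  where open ≡-Reasoning

c-zeros-ones : ∀ j k b n → c (zeros j ++ ones k) (zeros b ++ ones n) ≡ (b C j) * (n C k)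
c-zeros-ones j k b n = begin
  c (zeros j ++ ones k) (zeros b ++ ones n)
    ≡⟨ c-replicate-++ false (ones k) (ones n) (ones-ignores-false k) no-0∷ j b ⟩
  (b C j) * c (ones k) (ones n)            ≡⟨ cong ((b C j) *_) (c-replicate-replicate true k n) ⟩
  (b C j) * (n C k)                        ∎
  where
  open ≡-Reasoning
  no-0∷ : ∀ i → c (false ∷ zeros i ++ ones k) (ones n) ≡ 0
  no-0∷ i = c-ones-≡0 (here refl) n

c-pat-pat : ∀ i j k a b d → c (pat i (suc j) k) (pat a b d) ≡ (a C i) * (b C suc j) * (d C k)
c-pat-pat i j k a b d = begin
  c (ones i ++ r) (ones a ++ zeros b ++ ones d)
    ≡⟨ c-replicate-++ true r (zeros b ++ ones d) (∷-ignores-not false _) no-1∷ i a ⟩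
  (a C i) * c r (zeros b ++ ones d)           ≡⟨ cong ((a C i) *_) (c-zeros-ones (suc j) k b d) ⟩
  (a C i) * ((b C suc j) * (d C k))           ≡⟨ sym (*-assoc (a C i) (b C suc j) (d C k)) ⟩
  (a C i) * (b C suc j) * (d C k)             ∎
  where
  open ≡-Reasoning
  r = zeros (suc j) ++ ones k
  no-1∷ : ∀ i′ → c (true ∷ ones i′ ++ r) (zeros b ++ ones d) ≡ 0
  no-1∷ i′ = trans (ignores-replicate _ false (∷-ignores-not true _) b (ones d))
                   (c-ones-≡0 (there (∈-++⁺ʳ (ones i′) (here refl))) d)

c-replicate-++-≤ : ∀ x j p w → c (replicate j x ++ p) w ≤ (count x w C j) * c p w
c-replicate-++-≤ x zero    p w       = ≤-reflexive (sym (*-identityˡ (c p w)))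
c-replicate-++-≤ x (suc j) p []      = z≤n
c-replicate-++-≤ x (suc j) p (y ∷ w) with x ≟ᵇ y
... | yes refl = begin
  c (x ∷ xʲ ++ p) w + c (xʲ ++ p) w
    ≤⟨ +-mono-≤ (c-replicate-++-≤ x (suc j) p w) (c-replicate-++-≤ x j p w) ⟩
  (n C suc j) * c p w + (n C j) * c p w     ≡⟨ nC[k+1]*x+nCk*x≡[n+1]C[k+1]*x n j (c p w) ⟩
  (suc n C suc j) * c p w                   ≤⟨ *-monoʳ-≤ (suc n C suc j) (c-∷-≤ p x w) ⟩
  (suc n C suc j) * c p (x ∷ w)             ∎
  where
  open ≤-Reasoning
  xʲ = replicate j x
  n = count x w
... | no _ = begin
  c (x ∷ replicate j x ++ p) w + 0   ≡⟨ +-identityʳ _ ⟩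
  c (x ∷ replicate j x ++ p) w       ≤⟨ c-replicate-++-≤ x (suc j) p w ⟩
  (count x w C suc j) * c p w        ≤⟨ *-monoʳ-≤ (count x w C suc j) (c-∷-≤ p y w) ⟩
  (count x w C suc j) * c p (y ∷ w)  ∎
  where open ≤-Reasoning

c-ones-≤ : ∀ k w → c (ones k) w ≤ count true w C k
c-ones-≤ k w = begin
  c (ones k) w               ≡⟨ cong (λ p → c p w) (sym (++-identityʳ (ones k))) ⟩
  c (ones k ++ []) w         ≤⟨ c-replicate-++-≤ true k [] w ⟩
  (count true w C k) * 1     ≡⟨ *-identityʳ _ ⟩
  count true w C k           ∎
  where open ≤-Reasoning

c-zeros-ones-≤ : ∀ j k w → c (zeros j ++ ones k) w ≤ (count false w C j) * (count true w C k)
c-zeros-ones-≤ j k w = ≤-trans (c-replicate-++-≤ false j (ones k) w)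
                               (*-monoʳ-≤ (count false w C j) (c-ones-≤ k w))

replicate-++-∷ : ∀ {x : Bool} s w → replicate s x ++ x ∷ w ≡ x ∷ replicate s x ++ w
replicate-++-∷         zero    w = refl
replicate-++-∷ {x = x} (suc s) w = cong (x ∷_) (replicate-++-∷ s w)

c-ones-++-false∷ : ∀ i r s w → c (ones i ++ false ∷ r) (ones s ++ false ∷ w)
                              ≡ c (ones i ++ false ∷ r) (ones s ++ w) + (s C i) * c r w
c-ones-++-false∷ zero    r zero    w = cong (c (false ∷ r) w +_) (sym (*-identityˡ (c r w)))
c-ones-++-false∷ (suc i) r zero    w = refl
c-ones-++-false∷ zero    r (suc s) w = begin
  c (false ∷ r) (true ∷ ones s ++ false ∷ w)           ≡⟨ ∷-ignores-not false r (ones s ++ false ∷ w) ⟩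
  c (false ∷ r) (ones s ++ false ∷ w)                  ≡⟨ c-ones-++-false∷ zero r s w ⟩
  c (false ∷ r) (ones s ++ w) + (s C 0) * c r w
    ≡⟨ cong (_+ (s C 0) * c r w) (sym (∷-ignores-not false r (ones s ++ w))) ⟩
  c (false ∷ r) (true ∷ ones s ++ w) + (s C 0) * c r w ∎
  where open ≡-Reasoning
c-ones-++-false∷ (suc i) r (suc s) w = begin
  c P (ones s ++ false ∷ w) + c P′ (ones s ++ false ∷ w)
    ≡⟨ cong₂ _+_ (c-ones-++-false∷ (suc i) r s w) (c-ones-++-false∷ i r s w) ⟩
  (c P (ones s ++ w) + (s C suc i) * c r w) + (c P′ (ones s ++ w) + (s C i) * c r w)
    ≡⟨ interchange (c P (ones s ++ w)) _ (c P′ (ones s ++ w)) _ ⟩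
  (c P (ones s ++ w) + c P′ (ones s ++ w)) + ((s C suc i) * c r w + (s C i) * c r w)
    ≡⟨ cong (c P (ones s ++ w) + c P′ (ones s ++ w) +_) (nC[k+1]*x+nCk*x≡[n+1]C[k+1]*x s i (c r w)) ⟩
  (c P (ones s ++ w) + c P′ (ones s ++ w)) + (suc s C suc i) * c r w
    ∎
  where
  open ≡-Reasoning
  P  = ones (suc i) ++ false ∷ r
  P′ = ones i ++ false ∷ r

c-pat-≤ : ∀ i j k w s B →
          (∀ a → a ≤ count true w → ((s + a) C i) * ((count true w ∸ a) C k) ≤ B) →
          c (pat i (suc j) k) (ones s ++ w) ≤ (count false w C suc j) * B
c-pat-≤ i j k [] s B _ = ≤-reflexive (begin
  c (pat i (suc j) k) (ones s ++ []) ≡⟨ cong (c (pat i (suc j) k)) (++-identityʳ (ones s)) ⟩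
  c (pat i (suc j) k) (ones s)       ≡⟨ c-ones-≡0 (∈-++⁺ʳ (ones i) (here refl)) s ⟩
  0                                  ∎)
  where open ≡-Reasoning
c-pat-≤ i j k (true ∷ w) s B bound =
  subst (λ v → c (pat i (suc j) k) v ≤ (count false w C suc j) * B)
        (sym (replicate-++-∷ s w))
        (c-pat-≤ i j k w (suc s) B bound′)
  where
  bound′ : ∀ a → a ≤ count true w → ((suc s + a) C i) * ((count true w ∸ a) C k) ≤ B
  bound′ a a≤m = subst (λ t → (t C i) * ((count true w ∸ a) C k) ≤ B)
                       (+-suc s a) (bound (suc a) (s≤s a≤m))
c-pat-≤ i j k (false ∷ w) s B bound = begin
  c p (ones s ++ false ∷ w)                       ≡⟨ c-ones-++-false∷ i r s w ⟩
  c p (ones s ++ w) + (s C i) * c r w             ≤⟨ +-mono-≤ (c-pat-≤ i j k w s B bound)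
                                                              (*-monoʳ-≤ (s C i) (c-zeros-ones-≤ j k w)) ⟩
  (z C suc j) * B + (s C i) * ((z C j) * K)       ≡⟨ cong ((z C suc j) * B +_) (x∙yz≈y∙xz (s C i) (z C j) K) ⟩
  (z C suc j) * B + (z C j) * ((s C i) * K)       ≤⟨ +-monoʳ-≤ ((z C suc j) * B) (*-monoʳ-≤ (z C j) sCi*K≤B) ⟩
  (z C suc j) * B + (z C j) * B                   ≡⟨ nC[k+1]*x+nCk*x≡[n+1]C[k+1]*x z j B ⟩
  (suc z C suc j) * B                             ∎
  where
  open ≤-Reasoning
  p = pat i (suc j) k
  r = zeros j ++ ones k
  z = count false w
  K = count true w C k
  sCi*K≤B : (s C i) * K ≤ B
  sCi*K≤B = subst (λ t → (t C i) * K ≤ B) (+-identityʳ s) (bound 0 z≤n)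

≤-maximum : ∀ {x} xs → x ∈ xs → x ≤ maximum xs
≤-maximum (y ∷ ys) (here refl) = m≤m⊔n y (maximum ys)
≤-maximum (y ∷ ys) (there x∈ys) = ≤-trans (≤-maximum ys x∈ys) (m≤n⊔m y (maximum ys))

maximum-≤ : ∀ {B xs} → All (_≤ B) xs → maximum xs ≤ B
maximum-≤ []         = z≤n
maximum-≤ (x≤B ∷ xs≤B) = ⊔-lub x≤B (maximum-≤ xs≤B)

∃-argmax : ∀ (f : ℕ → ℕ) m → ∃[ a ] a ≤ m × (∀ b → b ≤ m → f b ≤ f a)
∃-argmax f m = argmax f 0 xs
             , argmax-all f z≤n (All.tabulate (λ x∈xs → ≤-pred (∈-upTo⁻ x∈xs)))
             , λ b b≤m → All.lookup (f[xs]≤f[argmax] {f = f} 0 xs) (∈-upTo⁺ (s≤s b≤m))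
  where xs = upTo (suc m)

extend : Word → List Word
extend w = (false ∷ w) ∷ (true ∷ w) ∷ []

∈-words : ∀ w → w ∈ words (length w)
∈-words []          = here refl
∈-words (false ∷ w) = ∈-concatMap⁺ extend (lose (∈-words w) (here refl))
∈-words (true ∷ w)  = ∈-concatMap⁺ extend (lose (∈-words w) (there (here refl)))

length-∈-words : ∀ {n w} → w ∈ words n → length w ≡ n
length-∈-words {zero}  (here refl) = refl
length-∈-words {suc n} w∈ with find (∈-concatMap⁻ extend {xs = words n} w∈)
... | v , v∈ , here refl         = cong suc (length-∈-words v∈)
... | v , v∈ , there (here refl) = cong suc (length-∈-words v∈)

c≤M : ∀ p w → c p w ≤ M (length w) p
c≤M p w = ≤-maximum _ (∈-map⁺ (c p) (∈-words w))

M-≤ : ∀ n p B → (∀ w → length w ≡ n → c p w ≤ B) → M n p ≤ B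
M-≤ n p B c≤B = maximum-≤ (map⁺ (All.tabulate (λ w∈ → c≤B _ (length-∈-words w∈))))

≤-tripleMax : ∀ i j k a b d → (a C i) * (b C j) * (d C k) ≤ tripleMax (a + b + d) i j k
≤-tripleMax i j k a b d =
  subst (_≤ tripleMax n i j k) (cong (λ t → (a C i) * (b C j) * (t C k)) n∸a∸b≡d)
  (≤-maximum _ (∈-concatMap⁺ row {xs = upTo (suc n)}
    (lose (∈-upTo⁺ (s≤s a≤n)) (∈-map⁺ (term a) (∈-upTo⁺ (s≤s b≤n∸a))))))
  where
  n = a + b + d
  term : ℕ → ℕ → ℕ
  term a′ b′ = (a′ C i) * (b′ C j) * ((n ∸ a′ ∸ b′) C k)
  row : ℕ → List ℕ
  row a′ = map (term a′) (upTo (suc (n ∸ a′)))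
  n∸a≡b+d : n ∸ a ≡ b + d
  n∸a≡b+d = trans (cong (_∸ a) (+-assoc a b d)) (m+n∸m≡n a (b + d))
  n∸a∸b≡d : n ∸ a ∸ b ≡ d
  n∸a∸b≡d = trans (cong (_∸ b) n∸a≡b+d) (m+n∸m≡n b d)
  a≤n : a ≤ n
  a≤n = ≤-trans (m≤m+n a b) (m≤m+n (a + b) d)
  b≤n∸a : b ≤ n ∸ a
  b≤n∸a = subst (b ≤_) (sym n∸a≡b+d) (m≤m+n b d)

tripleMax-≤ : ∀ n i j k B → (∀ a b d → a + b + d ≡ n → (a C i) * (b C j) * (d C k) ≤ B) →
              tripleMax n i j k ≤ B
tripleMax-≤ n i j k B term≤B = maximum-≤ (concat⁺ (map⁺ (All.tabulate λ {a} a∈ →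
  map⁺ (All.tabulate λ {b} b∈ →
    term≤B a b (n ∸ a ∸ b) (sum≡n (≤-pred (∈-upTo⁻ a∈)) (≤-pred (∈-upTo⁻ b∈)))))))
  where
  sum≡n : ∀ {a b} → a ≤ n → b ≤ n ∸ a → a + b + (n ∸ a ∸ b) ≡ n
  sum≡n {a} {b} a≤n b≤n∸a = begin
    a + b + (n ∸ a ∸ b)   ≡⟨ +-assoc a b (n ∸ a ∸ b) ⟩
    a + (b + (n ∸ a ∸ b)) ≡⟨ cong (a +_) (m+[n∸m]≡n b≤n∸a) ⟩
    a + (n ∸ a)           ≡⟨ m+[n∸m]≡n a≤n ⟩
    n                     ∎
    where open ≡-Reasoning

length-pat : ∀ a b d → length (pat a b d) ≡ a + b + d
length-pat a b d = begin
  length (ones a ++ zeros b ++ ones d)        ≡⟨ length-++ (ones a) ⟩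
  length (ones a) + length (zeros b ++ ones d) ≡⟨ cong₂ _+_ (length-replicate a) (length-++ (zeros b)) ⟩
  a + (length (zeros b) + length (ones d))    ≡⟨ cong (a +_) (cong₂ _+_ (length-replicate b) (length-replicate d)) ⟩
  a + (b + d)                                 ≡⟨ +-assoc a b d ⟨
  a + b + d                                   ∎
  where open ≡-Reasoning

c-pat-≤-tripleMax : ∀ i j k w → c (pat i (suc j) k) w ≤ tripleMax (length w) i (suc j) k
c-pat-≤-tripleMax i j k w =
  let a , a≤m , maximal = ∃-argmax (λ b → (b C i) * ((m ∸ b) C k)) m in begin
    c (pat i (suc j) k) w                     ≤⟨ c-pat-≤ i j k w 0 ((a C i) * ((m ∸ a) C k)) maximal ⟩
    (z C suc j) * ((a C i) * ((m ∸ a) C k))   ≡⟨ x∙yz≈y∙xz (z C suc j) (a C i) ((m ∸ a) C k) ⟩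
    (a C i) * ((z C suc j) * ((m ∸ a) C k))   ≡⟨ *-assoc (a C i) (z C suc j) ((m ∸ a) C k) ⟨
    (a C i) * (z C suc j) * ((m ∸ a) C k)     ≤⟨ ≤-tripleMax i (suc j) k a z (m ∸ a) ⟩
    tripleMax (a + z + (m ∸ a)) i (suc j) k   ≡⟨ cong (λ n → tripleMax n i (suc j) k) (a+z+[m∸a]≡length a≤m) ⟩
    tripleMax (length w) i (suc j) k          ∎
  where
  open ≤-Reasoning
  m = count true w
  z = count false w
  a+z+[m∸a]≡length : ∀ {a} → a ≤ m → a + z + (m ∸ a) ≡ length w
  a+z+[m∸a]≡length {a} a≤m = begin-equality
    a + z + (m ∸ a)   ≡⟨ cong (_+ (m ∸ a)) (+-comm a z) ⟩
    z + a + (m ∸ a)   ≡⟨ +-assoc z a (m ∸ a) ⟩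
    z + (a + (m ∸ a)) ≡⟨ cong (z +_) (m+[n∸m]≡n a≤m) ⟩
    z + m             ≡⟨ count-false+count-true w ⟩
    length w          ∎

M-pat-≤-tripleMax : ∀ n i j k → M n (pat i (suc j) k) ≤ tripleMax n i (suc j) k
M-pat-≤-tripleMax n i j k =
  M-≤ n (pat i (suc j) k) (tripleMax n i (suc j) k) λ { w refl → c-pat-≤-tripleMax i j k w }

tripleMax-≤-M-pat : ∀ n i j k → tripleMax n i (suc j) k ≤ M n (pat i (suc j) k)
tripleMax-≤-M-pat n i j k = tripleMax-≤ n i (suc j) k (M n p) λ { a b d refl → begin
  (a C i) * (b C suc j) * (d C k)  ≡⟨ c-pat-pat i j k a b d ⟨
  c p (pat a b d)                  ≤⟨ c≤M p (pat a b d) ⟩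
  M (length (pat a b d)) p         ≡⟨ cong (λ n → M n p) (length-pat a b d) ⟩
  M (a + b + d) p                  ∎ }
  where
  open ≤-Reasoning
  p = pat i (suc j) k

mainTheorem7 : (i j k : ℕ) → 1 ≤ j → (n : ℕ) → i + j + k ≤ n →
    M n (pat i j k) ≡ tripleMax n i j k
mainTheorem7 i (suc j) k (s≤s z≤n) n _ =
  ≤-antisym (M-pat-≤-tripleMax n i j k) (tripleMax-≤-M-pat n i j k)
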